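{- Let $\mathcal{C},\mathcal{D}$ be categories and $F\colon\mathcal{C}\to\mathcal{D}^{op}$ left adjoint to $G\colon\mathcal{D}^{op}\to\mathcal{C}$. Let $B$ be an endofunctor on $\mathcal{C}$ with final coalgebra $\zeta\colon\Theta\xrightarrow{\cong}B(\Theta)$, $(T,\eta,\mu)$ a monad on $\mathcal{C}$, $\kappa\colon TB\Rightarrow BT$ an Eilenberg-Moore law, $L$ an endofunctor on $\mathcal{D}$ with initial algebra $\alpha\colon L(\Phi)\xrightarrow{\cong}\Phi$, $\delta\colon BG\Rightarrow GL$ a natural transformation and $\tau\colon TG\Rightarrow G$ a monad action. Let $a\colon T(\Theta)\to\Theta$ be the unique map with $\zeta\circ a=B(a)\circ\kappa_\Theta\circ T(\zeta)$, let $\ell_{\mathrm{em}}=\zeta^{ -1}\circ B(a)\colon BT(\Theta)\to\Theta$, let $\ell^{\mathrm{log}}=G(\alpha^{ -1})\circ\delta_\Phi\circ B(\tau_\Phi)\colon BTG(\Phi)\to G(\Phi)$, and let $\mathsf{e}\colon\Theta\to G(\Phi)$ be the unique map with $\mathsf{e}=G(\alpha^{ -1})\circ\delta_\Phi\circ B(\mathsf{e})\circ\zeta$. Assume $\delta\circ B\tau\circ\kappa G=\tau L\circ T\delta$ (as natural transformations $TBG\Rightarrow GL$). Then $\mathsf{e}\circ\ell_{\mathrm{em}}=\ell^{\mathrm{log}}\circ BT(\mathsf{e})$. Consequently, for every coalgebra $c\colon X\to BT(X)$, $\mathsf{e}\circ\mathsf{em}_c=\mathsf{log}_c$, where $\mathsf{em}_c\colon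 X\to\Theta$ is the unique map with $\mathsf{em}_c=\ell_{\mathrm{em}}\circ BT(\mathsf{em}_c)\circ c$ and $\mathsf{log}_c\colon X\to G(\Phi)$ is the unique map with $\mathsf{log}_c=\ell^{\mathrm{log}}\circ BT(\mathsf{log}_c)\circ c$.
   Context: $L$ is also regarded as an endofunctor of $\mathcal{D}^{op}$; $\alpha^{ -1}\colon\Phi\to L(\Phi)$ in $\mathcal{D}$ is a morphism $L(\Phi)\to\Phi$ in $\mathcal{D}^{op}$, so $G(\alpha^{ -1})\colon GL(\Phi)\to G(\Phi)$. An Eilenberg-Moore law is a natural transformation $\kappa\colon TB\Rightarrow BT$ with $\kappa\circ\eta B=B\eta$ and $\kappa\circ\mu B=B\mu\circ\kappa T\circ T\kappa$. A monad action is a natural transformation $\tau\colon TG\Rightarrow G$ with $\tau\circ\eta G=\mathrm{id}$ and $\tau\circ\mu G=\tau\circ T\tau$. The maps $\mathsf{e}$, $\mathsf{em}_c$, $\mathsf{log}_c$ described exist and are unique (the algebras $G(\alpha^{ -1})\circ\delta_\Phi$, $\ell_{\mathrm{em}}$ and $\ell^{\mathrm{log}}$ are corecursive). -}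

module Defs where

open import Level using (Level; _⊔_; suc)
open import Data.Product using (Σ; _×_; _,_)
open import Relation.Binary using (IsEquivalence)

-- Categories with setoid-valued hom-sets (standard in Agda without quotients).
record Category (o ℓ e : Level) : Set (suc (o ⊔ ℓ ⊔ e)) where
  infixr 9 _∘_
  infix  4 _≈_
  field
    Obj   : Set o
    Hom   : Obj → Obj → Set ℓ
    _≈_   : ∀ {A B} → Hom A B → Hom A B → Set e
    id    : ∀ {A} → Hom A A
    _∘_   : ∀ {A B C} → Hom B C → Hom A B → Hom A C
    equiv     : ∀ {A B} → IsEquivalence (_≈_ {A} {B})
    ∘-resp-≈  : ∀ {A B C} {f h : Hom B C} {g i : Hom A B} →
                f ≈ h → g ≈ i → f ∘ g ≈ h ∘ i
    assoc     : ∀ {A B C D} {f : Hom A B} {g : Hom B C} {h : Hom C D} →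
                (h ∘ g) ∘ f ≈ h ∘ (g ∘ f)
    identityˡ : ∀ {A B} {f : Hom A B} → id ∘ f ≈ f
    identityʳ : ∀ {A B} {f : Hom A B} → f ∘ id ≈ f

op : ∀ {o ℓ e} → Category o ℓ e → Category o ℓ e
op C = record
  { Obj = Obj ; Hom = λ A B → Hom B A ; _≈_ = _≈_ ; id = id
  ; _∘_ = λ f g → g ∘ f ; equiv = equiv
  ; ∘-resp-≈ = λ p q → ∘-resp-≈ q p
  ; assoc = IsEquivalence.sym equiv assoc
  ; identityˡ = identityʳ ; identityʳ = identityˡ }
  where open Category C

record Functor {o ℓ e o′ ℓ′ e′} (C : Category o ℓ e) (D : Category o′ ℓ′ e′)
       : Set (o ⊔ ℓ ⊔ e ⊔ o′ ⊔ ℓ′ ⊔ e′) where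
  private
    module C = Category C
    module D = Category D
  field
    F₀ : C.Obj → D.Obj
    F₁ : ∀ {A B} → C.Hom A B → D.Hom (F₀ A) (F₀ B)
    identity     : ∀ {A} → F₁ (C.id {A}) D.≈ D.id
    homomorphism : ∀ {A B C} {f : C.Hom A B} {g : C.Hom B C} →
                   F₁ (g C.∘ f) D.≈ F₁ g D.∘ F₁ f
    F-resp-≈     : ∀ {A B} {f g : C.Hom A B} → f C.≈ g → F₁ f D.≈ F₁ g

Endofunctor : ∀ {o ℓ e} → Category o ℓ e → Set (o ⊔ ℓ ⊔ e)
Endofunctor C = Functor C C

opF : ∀ {o ℓ e o′ ℓ′ e′} {C : Category o ℓ e} {D : Category o′ ℓ′ e′} →
      Functor C D → Functor (op C) (op D)
opF F = record
  { F₀ = F₀ ; F₁ = F₁ ; identity = identity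
  ; homomorphism = homomorphism ; F-resp-≈ = F-resp-≈ }
  where open Functor F

idF : ∀ {o ℓ e} (C : Category o ℓ e) → Functor C C
idF C = record
  { F₀ = λ A → A ; F₁ = λ f → f ; identity = IsEquivalence.refl equiv
  ; homomorphism = IsEquivalence.refl equiv ; F-resp-≈ = λ p → p }
  where open Category C

_∘F_ : ∀ {o ℓ e o′ ℓ′ e′ o″ ℓ″ e″}
         {C : Category o ℓ e} {D : Category o′ ℓ′ e′} {E : Category o″ ℓ″ e″} →
       Functor D E → Functor C D → Functor C E
_∘F_ {E = E} G F = record
  { F₀ = λ A → G.F₀ (F.F₀ A)
  ; F₁ = λ f → G.F₁ (F.F₁ f)
  ; identity = Etrans (G.F-resp-≈ F.identity) G.identity
  ; homomorphism = Etrans (G.F-resp-≈ F.homomorphism) G.homomorphism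
  ; F-resp-≈ = λ p → G.F-resp-≈ (F.F-resp-≈ p) }
  where module G = Functor G
        module F = Functor F
        Etrans : ∀ {A B} {f g h : Category.Hom E A B} → Category._≈_ E f g →
                 Category._≈_ E g h → Category._≈_ E f h
        Etrans = IsEquivalence.trans (Category.equiv E)

record NaturalTransformation {o ℓ e o′ ℓ′ e′}
       {C : Category o ℓ e} {D : Category o′ ℓ′ e′} (F G : Functor C D)
       : Set (o ⊔ ℓ ⊔ e ⊔ o′ ⊔ ℓ′ ⊔ e′) where
  private
    module C = Category C
    module D = Category D
    module F = Functor F
    module G = Functor G
  field
    η       : ∀ X → D.Hom (F.F₀ X) (G.F₀ X)
    commute : ∀ {X Y} (f : C.Hom X Y) → η Y D.∘ F.F₁ f D.≈ G.F₁ f D.∘ η X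

record Monad {o ℓ e} (C : Category o ℓ e) : Set (o ⊔ ℓ ⊔ e) where
  open Category C
  field
    T : Endofunctor C
    η : NaturalTransformation (idF C) T
    μ : NaturalTransformation (T ∘F T) T
  open Functor T
  private
    module η = NaturalTransformation η
    module μ = NaturalTransformation μ
  field
    assoc′    : ∀ {X} → μ.η X ∘ F₁ (μ.η X) ≈ μ.η X ∘ μ.η (F₀ X)
    identityˡ′ : ∀ {X} → μ.η X ∘ F₁ (η.η X) ≈ id
    identityʳ′ : ∀ {X} → μ.η X ∘ η.η (F₀ X) ≈ id

record Adjunction {o ℓ e o′ ℓ′ e′} {C : Category o ℓ e} {D : Category o′ ℓ′ e′}
       (F : Functor C D) (G : Functor D C) : Set (o ⊔ ℓ ⊔ e ⊔ o′ ⊔ ℓ′ ⊔ e′) where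
  private
    module C = Category C
    module D = Category D
    module F = Functor F
    module G = Functor G
  field
    unit   : NaturalTransformation (idF C) (G ∘F F)
    counit : NaturalTransformation (F ∘F G) (idF D)
  private
    module unit = NaturalTransformation unit
    module counit = NaturalTransformation counit
  field
    zig : ∀ {A} → counit.η (F.F₀ A) D.∘ F.F₁ (unit.η A) D.≈ D.id
    zag : ∀ {B} → G.F₁ (counit.η B) C.∘ unit.η (G.F₀ B) C.≈ C.id

record EMLaw {o ℓ e} {C : Category o ℓ e} (M : Monad C) (B : Endofunctor C)
       : Set (o ⊔ ℓ ⊔ e) where
  open Category C
  open Monad M using (T; η; μ)
  private
    module T = Functor T
    module B = Functor B
    module η = NaturalTransformation η
    module μ = NaturalTransformation μ
  field
    κ : NaturalTransformation (T ∘F B) (B ∘F T)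
  private module κ = NaturalTransformation κ
  field
    law-η : ∀ {X} → κ.η X ∘ η.η (B.F₀ X) ≈ B.F₁ (η.η X)
    law-μ : ∀ {X} → κ.η X ∘ μ.η (B.F₀ X) ≈
                    B.F₁ (μ.η X) ∘ (κ.η (T.F₀ X) ∘ T.F₁ (κ.η X))

record MonadAction {o ℓ e o′ ℓ′ e′} {C : Category o ℓ e} {E : Category o′ ℓ′ e′}
       (M : Monad C) (G : Functor E C) : Set (o ⊔ ℓ ⊔ e ⊔ o′ ⊔ ℓ′ ⊔ e′) where
  open Category C
  open Monad M using (T; η; μ)
  private
    module T = Functor T
    module G = Functor G
    module η = NaturalTransformation η
    module μ = NaturalTransformation μ
  field
    τ : NaturalTransformation (T ∘F G) G
  private module τ = NaturalTransformation τ
  field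
    act-η : ∀ {X} → τ.η X ∘ η.η (G.F₀ X) ≈ id
    act-μ : ∀ {X} → τ.η X ∘ μ.η (G.F₀ X) ≈ τ.η X ∘ T.F₁ (τ.η X)

∃!≈ : ∀ {o ℓ e p} (C : Category o ℓ e) {A B : Category.Obj C}
      (P : Category.Hom C A B → Set p) → Set (ℓ ⊔ e ⊔ p)
∃!≈ C {A} {B} P = Σ (Hom A B) λ h → P h × (∀ h′ → P h′ → h′ ≈ h)
  where open Category C

record FinalCoalgebra {o ℓ e} {C : Category o ℓ e} (B : Endofunctor C)
       : Set (o ⊔ ℓ ⊔ e) where
  open Category C
  open Functor B
  field
    Θ     : Obj
    ζ     : Hom Θ (F₀ Θ)
    ζ⁻¹   : Hom (F₀ Θ) Θ
    isoˡ  : ζ⁻¹ ∘ ζ ≈ id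
    isoʳ  : ζ ∘ ζ⁻¹ ≈ id
    final : ∀ {X} (c : Hom X (F₀ X)) → ∃!≈ C (λ h → ζ ∘ h ≈ F₁ h ∘ c)

record InitialAlgebra {o ℓ e} {D : Category o ℓ e} (L : Endofunctor D)
       : Set (o ⊔ ℓ ⊔ e) where
  open Category D
  open Functor L
  field
    Φ       : Obj
    α       : Hom (F₀ Φ) Φ
    α⁻¹     : Hom Φ (F₀ Φ)
    isoˡ    : α⁻¹ ∘ α ≈ id
    isoʳ    : α ∘ α⁻¹ ≈ id
    initial : ∀ {X} (f : Hom (F₀ X) X) → ∃!≈ D (λ h → h ∘ α ≈ f ∘ F₁ h)

IsCorecursive : ∀ {o ℓ e} {C : Category o ℓ e} (F : Endofunctor C)
                {A : Category.Obj C} → Category.Hom C (Functor.F₀ F A) A →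
                Set (o ⊔ ℓ ⊔ e)
IsCorecursive {C = C} F {A} g =
  ∀ {X} (c : Hom X (F₀ X)) → ∃!≈ C (λ h → h ≈ g ∘ (F₁ h ∘ c))
  where open Category C
        open Functor F

-- The composite e ∘ a and the map τ ∘ T e are both coalgebra-to-algebra maps from
-- the B-coalgebra κ ∘ T ζ into the corecursive algebra G(α⁻¹) ∘ δ: for e ∘ a because a is
-- a coalgebra morphism into ζ, for τ ∘ T e because the compatibility condition makes τ a
-- morphism out of the κ-lifted algebra. Hence they agree, which rewrites e ∘ ℓem into
-- ℓlog ∘ BT e, so e is a morphism of BT-algebras; composing with e then carries em_c to
-- a coalgebra-to-algebra map into the corecursive ℓlog, i.e. to log_c.
module Submission where

open import Defs
open import Data.Product using (_×_; _,_)
open import Relation.Binary using (IsEquivalence; Setoid)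
import Relation.Binary.Reasoning.Setoid as SetoidReasoning

module HomReasoning {o ℓ e} (C : Category o ℓ e) where
  open Category C
  open module ≈ {A B} = IsEquivalence (equiv {A} {B}) public
    using () renaming (refl to ≈-refl; sym to ≈-sym; trans to ≈-trans)

  hom-setoid : Obj → Obj → Setoid ℓ e
  hom-setoid A B = record { Carrier = Hom A B ; _≈_ = _≈_ ; isEquivalence = equiv }

  module _ {A B : Obj} where
    open SetoidReasoning (hom-setoid A B) public

  sym-assoc : ∀ {A B C D} {f : Hom A B} {g : Hom B C} {h : Hom C D} →
              h ∘ (g ∘ f) ≈ (h ∘ g) ∘ f
  sym-assoc = ≈-sym assoc

  infixr 4 refl⟩∘⟨_
  infixl 5 _⟩∘⟨refl

  refl⟩∘⟨_ : ∀ {A B C} {f : Hom B C} {g i : Hom A B} → g ≈ i → f ∘ g ≈ f ∘ i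
  refl⟩∘⟨ p = ∘-resp-≈ ≈-refl p

  _⟩∘⟨refl : ∀ {A B C} {f h : Hom B C} {g : Hom A B} → f ≈ h → f ∘ g ≈ h ∘ g
  p ⟩∘⟨refl = ∘-resp-≈ p ≈-refl

module CoalgebraToAlgebra {o ℓ e} {C : Category o ℓ e} (F : Endofunctor C) where
  open Category C
  open Functor F
  open HomReasoning C

  IsCoalgebraToAlgebra : ∀ {X A} → Hom X (F₀ X) → Hom (F₀ A) A → Hom X A → Set e
  IsCoalgebraToAlgebra c g h = h ≈ g ∘ (F₁ h ∘ c)

  corecursive-unique : ∀ {X A} {c : Hom X (F₀ X)} {g : Hom (F₀ A) A} {h h′ : Hom X A} →
                       IsCorecursive F g →
                       IsCoalgebraToAlgebra c g h → IsCoalgebraToAlgebra c g h′ → h ≈ h′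
  corecursive-unique {c = c} corecursive p p′ with corecursive c
  ... | _ , _ , unique = ≈-trans (unique _ p) (≈-sym (unique _ p′))

  ∘-algebra-morphism : ∀ {X A A′} {c : Hom X (F₀ X)} {g : Hom (F₀ A) A}
                         {g′ : Hom (F₀ A′) A′} {f : Hom A A′} {h : Hom X A} →
                       f ∘ g ≈ g′ ∘ F₁ f →
                       IsCoalgebraToAlgebra c g h → IsCoalgebraToAlgebra c g′ (f ∘ h)
  ∘-algebra-morphism {c = c} {g} {g′} {f} {h} f-morphism h-map = begin
    f ∘ h                   ≈⟨ refl⟩∘⟨ h-map ⟩
    f ∘ (g ∘ (F₁ h ∘ c))    ≈⟨ sym-assoc ⟩
    (f ∘ g) ∘ (F₁ h ∘ c)    ≈⟨ f-morphism ⟩∘⟨refl ⟩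
    (g′ ∘ F₁ f) ∘ (F₁ h ∘ c) ≈⟨ assoc ⟩
    g′ ∘ (F₁ f ∘ (F₁ h ∘ c)) ≈⟨ refl⟩∘⟨ sym-assoc ⟩
    g′ ∘ ((F₁ f ∘ F₁ h) ∘ c) ≈⟨ refl⟩∘⟨ ≈-sym homomorphism ⟩∘⟨refl ⟩
    g′ ∘ (F₁ (f ∘ h) ∘ c)    ∎

  ∘-coalgebra-morphism : ∀ {X X′ A} {c : Hom X (F₀ X)} {c′ : Hom X′ (F₀ X′)}
                           {g : Hom (F₀ A) A} {m : Hom X X′} {h : Hom X′ A} →
                         c′ ∘ m ≈ F₁ m ∘ c →
                         IsCoalgebraToAlgebra c′ g h → IsCoalgebraToAlgebra c g (h ∘ m)
  ∘-coalgebra-morphism {c = c} {c′} {g} {m} {h} m-morphism h-map = begin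
    h ∘ m                     ≈⟨ h-map ⟩∘⟨refl ⟩
    (g ∘ (F₁ h ∘ c′)) ∘ m     ≈⟨ assoc ⟩
    g ∘ ((F₁ h ∘ c′) ∘ m)     ≈⟨ refl⟩∘⟨ assoc ⟩
    g ∘ (F₁ h ∘ (c′ ∘ m))     ≈⟨ refl⟩∘⟨ refl⟩∘⟨ m-morphism ⟩
    g ∘ (F₁ h ∘ (F₁ m ∘ c))   ≈⟨ refl⟩∘⟨ sym-assoc ⟩
    g ∘ ((F₁ h ∘ F₁ m) ∘ c)   ≈⟨ refl⟩∘⟨ ≈-sym homomorphism ⟩∘⟨refl ⟩
    g ∘ (F₁ (h ∘ m) ∘ c)      ∎

  ∘-section : ∀ {X A} {c : Hom X (F₀ X)} {s : Hom (F₀ X) X} {g : Hom (F₀ A) A}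
                {h : Hom X A} →
              c ∘ s ≈ id → IsCoalgebraToAlgebra c g h → h ∘ s ≈ g ∘ F₁ h
  ∘-section {c = c} {s} {g} {h} section h-map = begin
    h ∘ s                  ≈⟨ h-map ⟩∘⟨refl ⟩
    (g ∘ (F₁ h ∘ c)) ∘ s   ≈⟨ assoc ⟩
    g ∘ ((F₁ h ∘ c) ∘ s)   ≈⟨ refl⟩∘⟨ assoc ⟩
    g ∘ (F₁ h ∘ (c ∘ s))   ≈⟨ refl⟩∘⟨ refl⟩∘⟨ section ⟩
    g ∘ (F₁ h ∘ id)        ≈⟨ refl⟩∘⟨ identityʳ ⟩
    g ∘ F₁ h               ∎

module LiftAlongDistributiveLaw
  {o ℓ e} {C : Category o ℓ e} (B T : Endofunctor C)
  (κ : NaturalTransformation (T ∘F B) (B ∘F T)) where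
  open Category C
  open HomReasoning C
  open CoalgebraToAlgebra B
  private
    module B = Functor B
    module T = Functor T
    module κ = NaturalTransformation κ

  lift-coalgebra-to-algebra :
    ∀ {X A} {c : Hom X (B.F₀ X)} {g : Hom (B.F₀ A) A} {τ : Hom (T.F₀ A) A} {h : Hom X A} →
    τ ∘ T.F₁ g ≈ g ∘ (B.F₁ τ ∘ κ.η A) →
    IsCoalgebraToAlgebra c g h →
    IsCoalgebraToAlgebra (κ.η X ∘ T.F₁ c) g (τ ∘ T.F₁ h)
  lift-coalgebra-to-algebra {X} {A} {c} {g} {τ} {h} τ-morphism h-map = begin
    τ ∘ T.F₁ h
      ≈⟨ refl⟩∘⟨ ≈-trans (T.F-resp-≈ h-map)
                         (≈-trans T.homomorphism (refl⟩∘⟨ T.homomorphism)) ⟩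
    τ ∘ (T.F₁ g ∘ (T.F₁ (B.F₁ h) ∘ T.F₁ c))                ≈⟨ sym-assoc ⟩
    (τ ∘ T.F₁ g) ∘ (T.F₁ (B.F₁ h) ∘ T.F₁ c)                ≈⟨ τ-morphism ⟩∘⟨refl ⟩
    (g ∘ (B.F₁ τ ∘ κ.η A)) ∘ (T.F₁ (B.F₁ h) ∘ T.F₁ c)      ≈⟨ ≈-trans assoc (refl⟩∘⟨ assoc) ⟩
    g ∘ (B.F₁ τ ∘ (κ.η A ∘ (T.F₁ (B.F₁ h) ∘ T.F₁ c)))      ≈⟨ refl⟩∘⟨ refl⟩∘⟨ sym-assoc ⟩
    g ∘ (B.F₁ τ ∘ ((κ.η A ∘ T.F₁ (B.F₁ h)) ∘ T.F₁ c))      ≈⟨ refl⟩∘⟨ refl⟩∘⟨ κ.commute h ⟩∘⟨refl ⟩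
    g ∘ (B.F₁ τ ∘ ((B.F₁ (T.F₁ h) ∘ κ.η X) ∘ T.F₁ c))      ≈⟨ refl⟩∘⟨ refl⟩∘⟨ assoc ⟩
    g ∘ (B.F₁ τ ∘ (B.F₁ (T.F₁ h) ∘ (κ.η X ∘ T.F₁ c)))      ≈⟨ refl⟩∘⟨ sym-assoc ⟩
    g ∘ ((B.F₁ τ ∘ B.F₁ (T.F₁ h)) ∘ (κ.η X ∘ T.F₁ c))      ≈⟨ refl⟩∘⟨ ≈-sym B.homomorphism ⟩∘⟨refl ⟩
    g ∘ (B.F₁ (τ ∘ T.F₁ h) ∘ (κ.η X ∘ T.F₁ c))             ∎
theorem7p4 :
    ∀ {o ℓ e o′ ℓ′ e′} (C : Category o ℓ e) (D : Category o′ ℓ′ e′)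
      (F : Functor C (op D)) (G : Functor (op D) C) (adj : Adjunction F G)
      (B : Endofunctor C) (fc : FinalCoalgebra B)
      (M : Monad C) (law : EMLaw M B)
      (L : Endofunctor D) (ia : InitialAlgebra L)
      (δ : NaturalTransformation (B ∘F G) (G ∘F opF L))
      (act : MonadAction M G) →
    let open Category C
        open FinalCoalgebra fc
        open InitialAlgebra ia
        T = Monad.T M
        κ = NaturalTransformation.η (EMLaw.κ law)
        τ = NaturalTransformation.η (MonadAction.τ act)
        δ′ = NaturalTransformation.η δ
        B₀ = Functor.F₀ B
        B₁ = λ {X Y} → Functor.F₁ B {X} {Y}
        T₀ = Functor.F₀ T
        T₁ = λ {X Y} → Functor.F₁ T {X} {Y}
        G₀ = Functor.F₀ G
        G₁ = λ {X Y} → Functor.F₁ G {X} {Y}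
        L₀ = Functor.F₀ L
    in
    -- compatibility: δ ∘ Bτ ∘ κG = τL ∘ Tδ
    (∀ X → δ′ X ∘ B₁ (τ X) ∘ κ (G₀ X) ≈ τ (L₀ X) ∘ T₁ (δ′ X)) →
    -- a : T Θ → Θ, the unique map with ζ ∘ a = B(a) ∘ κ_Θ ∘ T(ζ)
    (a : Hom (T₀ Θ) Θ) → ζ ∘ a ≈ B₁ a ∘ κ Θ ∘ T₁ ζ →
    -- e : Θ → G Φ, the unique map with e = G(α⁻¹) ∘ δ_Φ ∘ B(e) ∘ ζ
    (e : Hom Θ (G₀ Φ)) → e ≈ G₁ α⁻¹ ∘ δ′ Φ ∘ B₁ e ∘ ζ →
    let ℓem = ζ⁻¹ ∘ B₁ a
        ℓlog = G₁ α⁻¹ ∘ δ′ Φ ∘ B₁ (τ Φ)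
    in
    -- the three algebras are corecursive (context)
    IsCorecursive B (G₁ α⁻¹ ∘ δ′ Φ) →
    IsCorecursive (B ∘F T) ℓem →
    IsCorecursive (B ∘F T) ℓlog →
    (e ∘ ℓem ≈ ℓlog ∘ B₁ (T₁ e))
    × (∀ {X} (c : Hom X (B₀ (T₀ X))) (em : Hom X Θ) (lg : Hom X (G₀ Φ)) →
         em ≈ ℓem ∘ B₁ (T₁ em) ∘ c →
         lg ≈ ℓlog ∘ B₁ (T₁ lg) ∘ c →
         e ∘ em ≈ lg)
theorem7p4 C _ _ G _ B fc M law _ ia δ act compatible a a-coalgebra-morphism
           e e-coalgebra-to-algebra corecursive _ corecursive-log =
  e∘ℓem≈ℓlog∘BTe , e∘em≈log
  where
  open Category C
  open HomReasoning C
  open FinalCoalgebra fc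
  open InitialAlgebra ia using (Φ; α⁻¹)
  open CoalgebraToAlgebra
  open LiftAlongDistributiveLaw B (Monad.T M) (EMLaw.κ law)
  module B = Functor B
  module T = Functor (Monad.T M)
  module G = Functor G
  κ = NaturalTransformation.η (EMLaw.κ law)
  module τ = NaturalTransformation (MonadAction.τ act)
  δ′ = NaturalTransformation.η δ
  g = G.F₁ α⁻¹ ∘ δ′ Φ
  ℓlog = G.F₁ α⁻¹ ∘ δ′ Φ ∘ B.F₁ (τ.η Φ)

  e-map : IsCoalgebraToAlgebra B ζ g e
  e-map = ≈-trans e-coalgebra-to-algebra sym-assoc

  τ-morphism : τ.η Φ ∘ T.F₁ g ≈ g ∘ (B.F₁ (τ.η Φ) ∘ κ (G.F₀ Φ))
  τ-morphism = begin
    τ.η Φ ∘ T.F₁ g                                       ≈⟨ refl⟩∘⟨ T.homomorphism ⟩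
    τ.η Φ ∘ (T.F₁ (G.F₁ α⁻¹) ∘ T.F₁ (δ′ Φ))               ≈⟨ sym-assoc ⟩
    (τ.η Φ ∘ T.F₁ (G.F₁ α⁻¹)) ∘ T.F₁ (δ′ Φ)               ≈⟨ τ.commute α⁻¹ ⟩∘⟨refl ⟩
    (G.F₁ α⁻¹ ∘ τ.η _) ∘ T.F₁ (δ′ Φ)                      ≈⟨ assoc ⟩
    G.F₁ α⁻¹ ∘ (τ.η _ ∘ T.F₁ (δ′ Φ))                      ≈⟨ refl⟩∘⟨ ≈-sym (compatible Φ) ⟩
    G.F₁ α⁻¹ ∘ (δ′ Φ ∘ (B.F₁ (τ.η Φ) ∘ κ (G.F₀ Φ)))       ≈⟨ sym-assoc ⟩
    g ∘ (B.F₁ (τ.η Φ) ∘ κ (G.F₀ Φ))                       ∎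

  e∘a≈τ∘Te : e ∘ a ≈ τ.η Φ ∘ T.F₁ e
  e∘a≈τ∘Te = corecursive-unique B corecursive
    (∘-coalgebra-morphism B a-coalgebra-morphism e-map)
    (lift-coalgebra-to-algebra τ-morphism e-map)

  e∘ℓem≈ℓlog∘BTe : e ∘ (ζ⁻¹ ∘ B.F₁ a) ≈ ℓlog ∘ B.F₁ (T.F₁ e)
  e∘ℓem≈ℓlog∘BTe = begin
    e ∘ (ζ⁻¹ ∘ B.F₁ a)                          ≈⟨ sym-assoc ⟩
    (e ∘ ζ⁻¹) ∘ B.F₁ a                          ≈⟨ ∘-section B isoʳ e-map ⟩∘⟨refl ⟩
    (g ∘ B.F₁ e) ∘ B.F₁ a                       ≈⟨ assoc ⟩
    g ∘ (B.F₁ e ∘ B.F₁ a)                       ≈⟨ refl⟩∘⟨ ≈-sym B.homomorphism ⟩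
    g ∘ B.F₁ (e ∘ a)                            ≈⟨ refl⟩∘⟨ B.F-resp-≈ e∘a≈τ∘Te ⟩
    g ∘ B.F₁ (τ.η Φ ∘ T.F₁ e)                   ≈⟨ refl⟩∘⟨ B.homomorphism ⟩
    g ∘ (B.F₁ (τ.η Φ) ∘ B.F₁ (T.F₁ e))          ≈⟨ ≈-trans sym-assoc (assoc ⟩∘⟨refl) ⟩
    ℓlog ∘ B.F₁ (T.F₁ e)                        ∎

  e∘em≈log : ∀ {X} (c : Hom X (B.F₀ (T.F₀ X))) (em : Hom X Θ) (lg : Hom X (G.F₀ Φ)) →
             IsCoalgebraToAlgebra (B ∘F Monad.T M) c (ζ⁻¹ ∘ B.F₁ a) em →
             IsCoalgebraToAlgebra (B ∘F Monad.T M) c ℓlog lg →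
             e ∘ em ≈ lg
  e∘em≈log _ _ _ em-map log-map = corecursive-unique (B ∘F Monad.T M) corecursive-log
    (∘-algebra-morphism (B ∘F Monad.T M) e∘ℓem≈ℓlog∘BTe em-map) log-map
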